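{- Let $n\ge 6$, $r_n=0^{n-4}1011$, and let $\mathrm{par}$ be defined on $\mathbf{A}(n)\setminus\{r_n\}$ by: $\mathrm{par}(\alpha)=\mathrm{FirstOne}(\alpha)$ if $\mathrm{FirstOne}(\alpha)\in\mathbf{A}(n)$; else $\mathrm{par}(\alpha)=\mathrm{LastOne}(\alpha)$ if $\mathrm{LastOne}(\alpha)\in\mathbf{A}(n)$; else $\mathrm{par}(\alpha)=\mathrm{LastZero}(\alpha)$. If $\beta\in\mathbf{A}(n)$ is periodic, then there is no $\alpha\in\mathbf{A}(n)\setminus\{r_n\}$ with $\mathrm{par}(\alpha)=\beta$ (i.e. periodic nodes of the tree defined by $\mathrm{par}$ have no children).
   Context: A binary string $\alpha$ is periodic if $\alpha=\gamma^j$ for some nonempty $\gamma$ and $j>1$, and aperiodic otherwise. Binary strings are compared lexicographically with $0<1$ (a proper prefix is smaller). For $\alpha=a_1\cdots a_n$, $\alpha^R=a_n\cdots a_1$. $[\alpha]$ is the set of rotations of $\alpha$; $\alpha$ is a necklace if it is lexicographically smallest in $[\alpha]$, and a bracelet if lexicographically smallest in $[\alpha]\cup[\alpha^R]$. A necklace $\alpha$ is symmetric if $\alpha^R\in[\alpha]$, otherwise asymmetric. $\mathbf{A}(n)$ is the set of length-$n$ asymmetric bracelets. For $\alpha=a_1\cdots a_n\in\mathbf{A}(n)$: $\mathrm{FirstOne}(\alpha)$ is $\alpha$ with its first $1$ flipped to $0$; $\mathrm{LastOne}(\alpha)$ is the necklace (lexicographically smallest rotation) of $a_1\cdots a_{n-1}0$;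 $\mathrm{LastZero}(\alpha)$ is $\alpha$ with its last $0$ flipped to $1$. -}

module Defs where

open import Data.Bool using (Bool; true; false)
open import Data.Nat using (ℕ; zero; suc; _<_; _≤_; _∸_)
open import Data.List using (List; []; _∷_; _++_; length; reverse; drop; take; replicate; concat; foldr; upTo; map; [_])
open import Data.Product using (_×_; Σ; ∃; ∃-syntax; _,_)
open import Data.Sum using (_⊎_)
open import Relation.Nullary using (¬_)
open import Relation.Binary.PropositionalEquality using (_≡_)

-- Binary strings: lists of Bool, with false = 0 and true = 1.
BStr : Set
BStr = List Bool

data _<ₗ_ : BStr → BStr → Set where
  []<∷  : ∀ {b xs} → [] <ₗ (b ∷ xs)
  0<1   : ∀ {xs ys} → (false ∷ xs) <ₗ (true ∷ ys)
  ∷<∷   : ∀ {b xs ys} → xs <ₗ ys → (b ∷ xs) <ₗ (b ∷ ys)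

_≤ₗ_ : BStr → BStr → Set
x ≤ₗ y = x <ₗ y ⊎ x ≡ y

rot : ℕ → BStr → BStr
rot k α = drop k α ++ take k α

_∈Rot_ : BStr → BStr → Set
β ∈Rot α = ∃[ k ] (k < length α × β ≡ rot k α)

IsNecklace : BStr → Set
IsNecklace α = ∀ β → β ∈Rot α → α ≤ₗ β

IsBracelet : BStr → Set
IsBracelet α = ∀ β → (β ∈Rot α ⊎ β ∈Rot reverse α) → α ≤ₗ β

IsSymmetric : BStr → Set
IsSymmetric α = reverse α ∈Rot α

-- membership in A(n): length-n asymmetric bracelets
-- (a bracelet is in particular a necklace)
InA : ℕ → BStr → Set
InA n α = length α ≡ n × IsBracelet α × ¬ IsSymmetric α

IsPeriodic : BStr → Set
IsPeriodic α = ∃[ γ ] ∃[ j ] (0 < length γ × 1 < j × α ≡ concat (replicate j γ))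

firstOne : BStr → BStr
firstOne []          = []
firstOne (false ∷ xs) = false ∷ firstOne xs
firstOne (true ∷ xs)  = false ∷ xs

lastZero : BStr → BStr
lastZero α = reverse (go (reverse α))
  where
  go : BStr → BStr
  go []           = []
  go (true ∷ xs)  = true ∷ go xs
  go (false ∷ xs) = true ∷ xs

minₗ : BStr → BStr → BStr
minₗ [] ys = []
minₗ (x ∷ xs) [] = []
minₗ (false ∷ xs) (true ∷ ys) = false ∷ xs
minₗ (true ∷ xs) (false ∷ ys) = false ∷ ys
minₗ (false ∷ xs) (false ∷ ys) = false ∷ minₗ xs ys
minₗ (true ∷ xs) (true ∷ ys) = true ∷ minₗ xs ys

neck : BStr → BStr
neck α = foldr (λ k acc → minₗ (rot k α) acc) α (upTo (length α))

setLastZero : BStr → BStr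
setLastZero α = take (length α ∸ 1) α ++ [ false ]

lastOne : BStr → BStr
lastOne α = neck (setLastZero α)

r : ℕ → BStr
r n = replicate (n ∸ 4) false ++ (true ∷ false ∷ true ∷ true ∷ [])

Par : ℕ → BStr → BStr → Set
Par n α β =
    (InA n (firstOne α) × β ≡ firstOne α)
  ⊎ (¬ InA n (firstOne α) × InA n (lastOne α) × β ≡ lastOne α)
  ⊎ (¬ InA n (firstOne α) × ¬ InA n (lastOne α) × β ≡ lastZero α)

-- Let p be a period of β with 2p ≤ n, so rot p β ≡ β.  Constant strings and the strings
-- 0…0b are symmetric, so neither α nor β has that shape.  Each branch of par changes a
-- single letter of α (LastOne after setting the last letter to 0 and rotating).  Moving
-- the changed letter by the period shows that rot p α (for LastOne, rot (p - 1) α) agrees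
-- with α up to a position where it has a 0 and α a 1, which is impossible for a bracelet;
-- the one exception, LastZero acting before position p, would make β constant.
module Submission where

open import Defs
open import Data.Bool using (Bool; true; false)
open import Data.Empty using (⊥; ⊥-elim)
open import Data.List
  using (List; []; _∷_; _++_; _∷ʳ_; [_]; length; reverse; drop; take; replicate; concat; foldr; upTo;
         initLast; _∷ʳ′_)
open import Data.List.Properties
  using (length-++; length-++-comm; length-drop; length-replicate; length-reverse; take-all; drop-all;
         drop-drop; take++drop≡id; ++-assoc; ++-identityʳ; reverse-++; unfold-reverse;
         reverse-involutive; ∷-injective; ∷-injectiveʳ)
open import Data.List.Relation.Unary.All using (All; []; _∷_)
open import Data.List.Relation.Unary.All.Properties using (all-upTo)
open import Data.Nat using (ℕ; zero; suc; _+_; _∸_; _≤_; _<_; z≤n; s≤s; _≤?_)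
open import Data.Nat.Properties
open import Data.Product using (∃-syntax; _×_; _,_; proj₁; proj₂)
open import Data.Sum using (_⊎_; inj₁; inj₂)
open import Relation.Nullary using (¬_; yes; no)
open import Relation.Binary.PropositionalEquality
  using (_≡_; _≢_; refl; sym; trans; cong; cong₂; subst; subst₂; module ≡-Reasoning)

private
  variable
    A : Set

zeros ones : ℕ → BStr
zeros i = replicate i false
ones i = replicate i true

Constant : Bool → BStr → Set
Constant b x = x ≡ replicate (length x) b

HasPeriod : ℕ → BStr → Set
HasPeriod p x = rot p x ≡ x

take-length-++ : ∀ (t : List A) {y} → take (length t) (t ++ y) ≡ t
take-length-++ []      = refl
take-length-++ (x ∷ t) = cong (x ∷_) (take-length-++ t)

drop-length-++ : ∀ (t : List A) {y} → drop (length t) (t ++ y) ≡ y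
drop-length-++ []      = refl
drop-length-++ (x ∷ t) = drop-length-++ t

take-++ˡ : ∀ k (t : List A) {y} → k ≤ length t → take k (t ++ y) ≡ take k t
take-++ˡ zero    t       _         = refl
take-++ˡ (suc k) (x ∷ t) (s≤s k≤) = cong (x ∷_) (take-++ˡ k t k≤)

drop-++ˡ : ∀ k (t : List A) {y} → k ≤ length t → drop k (t ++ y) ≡ drop k t ++ y
drop-++ˡ zero    t       _         = refl
drop-++ˡ (suc k) (x ∷ t) (s≤s k≤) = drop-++ˡ k t k≤

drop-++ʳ : ∀ k (t : List A) {y} → length t ≤ k → drop k (t ++ y) ≡ drop (k ∸ length t) y
drop-++ʳ k       []      _         = refl
drop-++ʳ (suc k) (x ∷ t) (s≤s t≤) = drop-++ʳ k t t≤

drop-beyond-∷ : ∀ k (t : List A) {b c s} → length t < k → drop k (t ++ b ∷ s) ≡ drop k (t ++ c ∷ s)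
drop-beyond-∷ (suc k) []      _         = refl
drop-beyond-∷ (suc k) (x ∷ t) (s≤s t<) = drop-beyond-∷ k t t<

take-+ : ∀ m n (xs : List A) → take (m + n) xs ≡ take m xs ++ take n (drop m xs)
take-+ zero    n xs       = refl
take-+ (suc m) n []       = sym (take-all n [] z≤n)
take-+ (suc m) n (x ∷ xs) = cong (x ∷_) (take-+ m n xs)

++-prefix : ∀ (a d : List A) {e s} → length a ≤ length d → d ++ e ≡ a ++ s → ∃[ d' ] d ≡ a ++ d'
++-prefix []      d       _         _  = d , refl
++-prefix (y ∷ a) (x ∷ d) (s≤s a≤) eq with refl , eq' ← ∷-injective eq
  with d' , refl ← ++-prefix a d a≤ eq' = d' , refl

++-prefix-∷ : ∀ (a d : List A) {c e s} → length a < length d → d ++ e ≡ a ++ c ∷ s →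
              ∃[ d' ] d ≡ a ++ c ∷ d'
++-prefix-∷ []      (x ∷ d) _         eq with refl , _ ← ∷-injective eq = d , refl
++-prefix-∷ (y ∷ a) (x ∷ d) (s≤s a<) eq with refl , eq' ← ∷-injective eq
  with d' , refl ← ++-prefix-∷ a d a< eq' = d' , refl

length-++-∷ : ∀ (t : List A) {b c s} → length (t ++ b ∷ s) ≡ length (t ++ c ∷ s)
length-++-∷ []      = refl
length-++-∷ (_ ∷ t) = cong suc (length-++-∷ t)

drop-replicate : ∀ k m {b : A} → drop k (replicate m b) ≡ replicate (m ∸ k) b
drop-replicate zero    m       = refl
drop-replicate (suc k) zero    = refl
drop-replicate (suc k) (suc m) = drop-replicate k m

replicate-+ : ∀ m n {b : A} → replicate m b ++ replicate n b ≡ replicate (m + n) b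
replicate-+ zero    n = refl
replicate-+ (suc m) n = cong (_ ∷_) (replicate-+ m n)

reverse-replicate : ∀ n {b : A} → reverse (replicate n b) ≡ replicate n b
reverse-replicate zero        = refl
reverse-replicate (suc n) {b} = begin
  reverse (b ∷ replicate n b)    ≡⟨ unfold-reverse b (replicate n b) ⟩
  reverse (replicate n b) ∷ʳ b   ≡⟨ cong (_∷ʳ b) (reverse-replicate n) ⟩
  replicate n b ++ replicate 1 b ≡⟨ replicate-+ n 1 ⟩
  replicate (n + 1) b            ≡⟨ cong (λ m → replicate m b) (+-comm n 1) ⟩
  replicate (suc n) b            ∎
  where open ≡-Reasoning

replicate-constant : ∀ n b → Constant b (replicate n b)
replicate-constant n b = cong (λ m → replicate m b) (sym (length-replicate n))

constant-++ : ∀ {b} x y → Constant b x → Constant b y → Constant b (x ++ y)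
constant-++ {b} x y cx cy = begin
  x ++ y                                           ≡⟨ cong₂ _++_ cx cy ⟩
  replicate (length x) b ++ replicate (length y) b ≡⟨ replicate-+ (length x) (length y) ⟩
  replicate (length x + length y) b                ≡⟨ cong (λ m → replicate m b) (sym (length-++ x)) ⟩
  replicate (length (x ++ y)) b                    ∎
  where open ≡-Reasoning

constant-prefix : ∀ m {b} t {d} → replicate m b ≡ t ++ d → Constant b t
constant-prefix m       []      _  = refl
constant-prefix (suc m) (x ∷ t) eq with refl , eq' ← ∷-injective eq =
  cong (x ∷_) (constant-prefix m t eq')

replicate-symmetric : ∀ {x} m {b} → 0 < length x → x ≡ replicate m b → IsSymmetric x
replicate-symmetric {x} m {b} x>0 x≡ = 0 , x>0 , (begin
  reverse x               ≡⟨ cong reverse x≡ ⟩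
  reverse (replicate m b) ≡⟨ reverse-replicate m ⟩
  replicate m b           ≡⟨ sym x≡ ⟩
  x                       ≡⟨ sym (++-identityʳ x) ⟩
  rot 0 x                 ∎)
  where open ≡-Reasoning

length-rot : ∀ k (x : BStr) → length (rot k x) ≡ length x
length-rot k x = trans (length-++-comm (drop k x) (take k x)) (cong length (take++drop≡id k x))

rot-++ˡ : ∀ k (t : BStr) {y} → k ≤ length t → rot k (t ++ y) ≡ drop k t ++ y ++ take k t
rot-++ˡ k t {y} k≤ =
  trans (cong₂ _++_ (drop-++ˡ k t k≤) (take-++ˡ k t k≤)) (++-assoc (drop k t) y (take k t))

rot-length : ∀ (x : BStr) → rot (length x) x ≡ x
rot-length x = cong₂ _++_ (drop-all (length x) x ≤-refl) (take-all (length x) x ≤-refl)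

rot-length-∷ʳ : ∀ (u : BStr) c → rot (length u) (u ∷ʳ c) ≡ c ∷ u
rot-length-∷ʳ u c = cong₂ _++_ (drop-length-++ u) (take-length-++ u)

rot-rot : ∀ a b (x : BStr) → a + b ≤ length x → rot a (rot b x) ≡ rot (b + a) x
rot-rot a b x a+b≤ = begin
  rot a (drop b x ++ take b x)                       ≡⟨ rot-++ˡ a (drop b x) a≤ ⟩
  drop a (drop b x) ++ take b x ++ take a (drop b x) ≡⟨ cong₂ _++_ (drop-drop b a x) (sym (take-+ b a x)) ⟩
  rot (b + a) x                                      ∎
  where
  open ≡-Reasoning
  a≤ : a ≤ length (drop b x)
  a≤ = subst (a ≤_) (sym (length-drop b x)) (m+n≤o⇒m≤o∸n a a+b≤)

rot-rot-∸ : ∀ k (x : BStr) → k ≤ length x → rot (length x ∸ k) (rot k x) ≡ x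
rot-rot-∸ k x k≤ = begin
  rot (length x ∸ k) (rot k x) ≡⟨ rot-rot (length x ∸ k) k x (≤-reflexive (m∸n+n≡m k≤)) ⟩
  rot (k + (length x ∸ k)) x   ≡⟨ cong (λ m → rot m x) (m+[n∸m]≡n k≤) ⟩
  rot (length x) x             ≡⟨ rot-length x ⟩
  x                            ∎
  where open ≡-Reasoning

rot-rot-wrap : ∀ a b (x : BStr) → a ≤ length x → b ≤ length x → length x < a + b →
               rot a (rot b x) ≡ rot (a + b ∸ length x) x
rot-rot-wrap a b x a≤ b≤ n<a+b = begin
  rot a (rot b x)         ≡⟨ cong (λ m → rot m (rot b x)) (sym c+e≡a) ⟩
  rot (c + e) (rot b x)   ≡⟨ sym (rot-rot e c (rot b x) e+c≤) ⟩
  rot e (rot c (rot b x)) ≡⟨ cong (rot e) (rot-rot-∸ b x b≤) ⟩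
  rot e x                 ∎
  where
  open ≡-Reasoning
  n = length x
  c = n ∸ b
  e = a + b ∸ n
  b+c≡n : b + c ≡ n
  b+c≡n = m+[n∸m]≡n b≤
  c<a : c < a
  c<a = +-cancelˡ-< b c a (subst₂ _<_ (sym b+c≡n) (+-comm a b) n<a+b)
  c+e≡a : c + e ≡ a
  c+e≡a = begin
    c + (a + b ∸ n)       ≡⟨ cong (λ m → c + (m ∸ n)) (+-comm a b) ⟩
    c + (b + a ∸ n)       ≡⟨ cong (λ m → c + (b + a ∸ m)) (sym b+c≡n) ⟩
    c + (b + a ∸ (b + c)) ≡⟨ cong (c +_) ([m+n]∸[m+o]≡n∸o b a c) ⟩
    c + (a ∸ c)           ≡⟨ m+[n∸m]≡n (<⇒≤ c<a) ⟩
    a                     ∎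
  e+c≤ : e + c ≤ length (rot b x)
  e+c≤ = subst₂ _≤_ (trans (sym c+e≡a) (+-comm c e)) (sym (length-rot b x)) a≤

rot-rot-comm : ∀ a b (x : BStr) → a ≤ length x → b ≤ length x → rot a (rot b x) ≡ rot b (rot a x)
rot-rot-comm a b x a≤ b≤ with a + b ≤? length x
... | yes a+b≤ = begin
  rot a (rot b x) ≡⟨ rot-rot a b x a+b≤ ⟩
  rot (b + a) x   ≡⟨ cong (λ m → rot m x) (+-comm b a) ⟩
  rot (a + b) x   ≡⟨ sym (rot-rot b a x (subst (_≤ length x) (+-comm a b) a+b≤)) ⟩
  rot b (rot a x) ∎
  where open ≡-Reasoning
... | no a+b≰ = begin
  rot a (rot b x)          ≡⟨ rot-rot-wrap a b x a≤ b≤ n<a+b ⟩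
  rot (a + b ∸ length x) x ≡⟨ cong (λ m → rot (m ∸ length x) x) (+-comm a b) ⟩
  rot (b + a ∸ length x) x ≡⟨ sym (rot-rot-wrap b a x b≤ a≤ (subst (length x <_) (+-comm a b) n<a+b)) ⟩
  rot b (rot a x)          ∎
  where
  open ≡-Reasoning
  n<a+b = ≰⇒> a+b≰

short-period-< : ∀ {p n} → 0 < p → p + p ≤ n → p < n
short-period-< {p} p>0 2p≤n = <-≤-trans (m<m+n p p>0) 2p≤n

<-period⇒<-∸ : ∀ {i p n} → i < p → p + p ≤ n → i < n ∸ p
<-period⇒<-∸ {p = p} i<p 2p≤n = <-≤-trans i<p (m+n≤o⇒m≤o∸n p 2p≤n)

short-period-pos : ∀ {p n} → 0 < p → p + p ≤ n → 0 < n
short-period-pos p>0 2p≤n = <-trans p>0 (short-period-< p>0 2p≤n)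

period-∸ : ∀ {p} x → p ≤ length x → HasPeriod p x → HasPeriod (length x ∸ p) x
period-∸ {p} x p≤ per = trans (cong (rot (length x ∸ p)) (sym per)) (rot-rot-∸ p x p≤)

period-rot : ∀ {p} k x → p ≤ length x → k ≤ length x → HasPeriod p x → HasPeriod p (rot k x)
period-rot {p} k x p≤ k≤ per = trans (rot-rot-comm p k x p≤ k≤) (cong (rot k) per)

period-pred-∷ʳ : ∀ p u {c} → suc p ≤ length (u ∷ʳ c) → HasPeriod (suc p) (u ∷ʳ c) →
                 rot p (u ∷ʳ c) ≡ c ∷ u
period-pred-∷ʳ p u {c} p<n per = begin
  rot p x                   ≡⟨ cong (rot p) (sym (period-∸ x p<n per)) ⟩
  rot p (rot (n ∸ suc p) x) ≡⟨ rot-rot p (n ∸ suc p) x (subst (_≤ n) (trans (sym k≡m) (+-comm _ p)) m≤n) ⟩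
  rot (n ∸ suc p + p) x     ≡⟨ cong (λ k → rot k x) k≡m ⟩
  rot (length u) x          ≡⟨ rot-length-∷ʳ u c ⟩
  c ∷ u                     ∎
  where
  open ≡-Reasoning
  x = u ∷ʳ c
  n = length x
  n≡1+m : n ≡ suc (length u)
  n≡1+m = trans (length-++ u) (+-comm (length u) 1)
  m≤n : length u ≤ n
  m≤n = subst (length u ≤_) (sym n≡1+m) (n≤1+n (length u))
  k≡m : n ∸ suc p + p ≡ length u
  k≡m = trans (cong (λ l → l ∸ suc p + p) n≡1+m) (m∸n+n≡m (≤-pred (subst (suc p ≤_) n≡1+m p<n)))

zeros-++-true-injective : ∀ a b {x y} → zeros a ++ true ∷ x ≡ zeros b ++ true ∷ y → a ≡ b
zeros-++-true-injective zero    zero    _  = refl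
zeros-++-true-injective zero    (suc b) ()
zeros-++-true-injective (suc a) zero    ()
zeros-++-true-injective (suc a) (suc b) eq = cong suc (zeros-++-true-injective a b (∷-injectiveʳ eq))

period-leading-zeros : ∀ {p x z w} → 0 < p → HasPeriod p x → x ≡ zeros z ++ true ∷ w → z < p
period-leading-zeros {p} {x} {z} {w} p>0 per refl with p ≤? z
... | no p≰z = ≰⇒> p≰z
... | yes p≤z = ⊥-elim (<⇒≢ (∸-monoʳ-< p>0 p≤z) (zeros-++-true-injective (z ∸ p) z rot≡))
  where
  open ≡-Reasoning
  drop≡ : drop p x ≡ zeros (z ∸ p) ++ true ∷ w
  drop≡ = begin
    drop p (zeros z ++ true ∷ w) ≡⟨ drop-++ˡ p (zeros z) (subst (p ≤_) (sym (length-replicate z)) p≤z) ⟩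
    drop p (zeros z) ++ true ∷ w ≡⟨ cong (_++ true ∷ w) (drop-replicate p z) ⟩
    zeros (z ∸ p) ++ true ∷ w    ∎
  rot≡ : zeros (z ∸ p) ++ true ∷ (w ++ take p x) ≡ x
  rot≡ = begin
    zeros (z ∸ p) ++ true ∷ (w ++ take p x) ≡⟨ sym (++-assoc (zeros (z ∸ p)) (true ∷ w) (take p x)) ⟩
    (zeros (z ∸ p) ++ true ∷ w) ++ take p x ≡⟨ cong (_++ take p x) (sym drop≡) ⟩
    rot p x                                 ≡⟨ per ⟩
    x                                       ∎

period-pred-drop : ∀ p u {c} → suc p ≤ length (u ∷ʳ c) → HasPeriod (suc p) (u ∷ʳ c) →
                   drop p u ++ c ∷ take p u ≡ c ∷ u
period-pred-drop p u {c} p<n per =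
  trans (sym (rot-++ˡ p u p≤m)) (period-pred-∷ʳ p u p<n per)
  where
  p≤m : p ≤ length u
  p≤m = ≤-pred (subst (suc p ≤_) (trans (length-++ u) (+-comm (length u) 1)) p<n)

period-constant-suffix : ∀ {p b} t m → length t ≤ p → p ≤ m → HasPeriod p (t ++ replicate m b) →
                         Constant b (t ++ replicate m b)
period-constant-suffix {p} {b} t m t≤p p≤m per =
  constant-++ t (replicate m b) t-const (replicate-constant m b)
  where
  x = t ++ replicate m b
  k = m ∸ (p ∸ length t)
  t≤k : length t ≤ k
  t≤k = m+n≤o⇒m≤o∸n (length t) (subst (_≤ m) (sym (m+[n∸m]≡n t≤p)) p≤m)
  drop≡ : drop p x ≡ replicate k b
  drop≡ = trans (drop-++ʳ p t t≤p) (drop-replicate (p ∸ length t) m)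
  x≡ : replicate k b ++ take p x ≡ t ++ replicate m b
  x≡ = trans (cong (_++ take p x) (sym drop≡)) per
  t-const : Constant b t
  t-const with _ , eq ← ++-prefix t (replicate k b) (subst (length t ≤_) (sym (length-replicate k)) t≤k) x≡
    = constant-prefix k t eq

concat-replicate-comm : ∀ j (γ : List A) → concat (replicate j γ) ++ γ ≡ γ ++ concat (replicate j γ)
concat-replicate-comm zero    γ = sym (++-identityʳ γ)
concat-replicate-comm (suc j) γ = trans (++-assoc γ _ γ) (cong (γ ++_) (concat-replicate-comm j γ))

periodic⇒short-period : ∀ {β} → IsPeriodic β → ∃[ p ] 0 < p × p + p ≤ length β × HasPeriod p β
periodic⇒short-period (γ , 1 , _ , s≤s () , _)
periodic⇒short-period (γ , suc (suc j) , γ>0 , _ , refl) = length γ , γ>0 , 2p≤n , per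
  where
  γʲ = concat (replicate (suc j) γ)
  2p≤n : length γ + length γ ≤ length (γ ++ γʲ)
  2p≤n = subst (length γ + length γ ≤_) (sym (length-++ γ))
           (+-monoʳ-≤ (length γ) (subst (length γ ≤_) (sym (length-++ γ)) (m≤m+n (length γ) _)))
  per : HasPeriod (length γ) (γ ++ γʲ)
  per = trans (cong₂ _++_ (drop-length-++ γ) (take-length-++ γ)) (concat-replicate-comm (suc j) γ)

<ₗ-irrefl : ∀ {x} → ¬ x <ₗ x
<ₗ-irrefl (∷<∷ x<x) = <ₗ-irrefl x<x

<ₗ-asym : ∀ {x y} → x <ₗ y → ¬ y <ₗ x
<ₗ-asym (∷<∷ x<y) (∷<∷ y<x) = <ₗ-asym x<y y<x

<ₗ⇒≱ₗ : ∀ {x y} → x <ₗ y → ¬ y ≤ₗ x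
<ₗ⇒≱ₗ x<y (inj₁ y<x) = <ₗ-asym x<y y<x
<ₗ⇒≱ₗ x<y (inj₂ refl) = <ₗ-irrefl x<y

flip-<ₗ : ∀ X {Y W} → (X ++ false ∷ Y) <ₗ (X ++ true ∷ W)
flip-<ₗ []      = 0<1
flip-<ₗ (_ ∷ X) = ∷<∷ (flip-<ₗ X)

bracelet-rot-≮ₗ : ∀ {α k} → IsBracelet α → k < length α → ¬ rot k α <ₗ α
bracelet-rot-≮ₗ {α} {k} br k< rot<α = <ₗ⇒≱ₗ rot<α (br (rot k α) (inj₁ (k , k< , refl)))

bracelet-rot-flip : ∀ {α k} X {Y W} → IsBracelet α → k < length α →
                    α ≡ X ++ true ∷ W → rot k α ≡ X ++ false ∷ Y → ⊥
bracelet-rot-flip X br k< refl rot≡ = bracelet-rot-≮ₗ br k< (subst (_<ₗ _) (sym rot≡) (flip-<ₗ X))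

zeros-or-first-one : ∀ x → x ≡ zeros (length x) ⊎ ∃[ i ] ∃[ w ] x ≡ zeros i ++ true ∷ w
zeros-or-first-one []          = inj₁ refl
zeros-or-first-one (true ∷ x)  = inj₂ (0 , x , refl)
zeros-or-first-one (false ∷ x) with zeros-or-first-one x
... | inj₁ x≡0ⁿ          = inj₁ (cong (false ∷_) x≡0ⁿ)
... | inj₂ (i , w , x≡) = inj₂ (suc i , w , cong (false ∷_) x≡)

zeros-≤-first-one : ∀ m z {s w} → zeros m ++ s ≡ zeros z ++ true ∷ w → m ≤ z
zeros-≤-first-one zero    z       _  = z≤n
zeros-≤-first-one (suc m) (suc z) eq = s≤s (zeros-≤-first-one m z (∷-injectiveʳ eq))

zeros-suc : ∀ i {s} → zeros (suc i) ++ s ≡ zeros i ++ false ∷ s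
zeros-suc zero    = refl
zeros-suc (suc i) = cong (false ∷_) (zeros-suc i)

minₗ-either : ∀ x y → minₗ x y ≡ x ⊎ minₗ x y ≡ y
minₗ-either []          _           = inj₁ refl
minₗ-either (_ ∷ _)     []          = inj₂ refl
minₗ-either (false ∷ _) (true ∷ _)  = inj₁ refl
minₗ-either (true ∷ _)  (false ∷ _) = inj₂ refl
minₗ-either (false ∷ x) (false ∷ y) with minₗ-either x y
... | inj₁ eq = inj₁ (cong (false ∷_) eq)
... | inj₂ eq = inj₂ (cong (false ∷_) eq)
minₗ-either (true ∷ x)  (true ∷ y)  with minₗ-either x y
... | inj₁ eq = inj₁ (cong (true ∷_) eq)
... | inj₂ eq = inj₂ (cong (true ∷_) eq)

RotationOf : BStr → BStr → Set
RotationOf x y = y ≡ x ⊎ y ∈Rot x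

foldr-minₗ-rotation : ∀ x ks → All (_< length x) ks →
                      RotationOf x (foldr (λ k acc → minₗ (rot k x) acc) x ks)
foldr-minₗ-rotation x []       []         = inj₁ refl
foldr-minₗ-rotation x (k ∷ ks) (k< ∷ ks<)
  with minₗ-either (rot k x) (foldr (λ k acc → minₗ (rot k x) acc) x ks)
... | inj₁ eq = inj₂ (k , k< , eq)
... | inj₂ eq with foldr-minₗ-rotation x ks ks<
...   | inj₁ eq'               = inj₁ (trans eq eq')
...   | inj₂ (k' , k'< , eq') = inj₂ (k' , k'< , trans eq eq')

neck-rotation : ∀ x → RotationOf x (neck x)
neck-rotation x = foldr-minₗ-rotation x (upTo (length x)) (all-upTo (length x))

rotation-period : ∀ {p} x {y} → p ≤ length x → RotationOf x y → HasPeriod p y → HasPeriod p x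
rotation-period x p≤ (inj₁ refl) per = per
rotation-period {p} x p≤ (inj₂ (k , k< , refl)) per =
  subst (HasPeriod p) (rot-rot-∸ k x (<⇒≤ k<)) (period-rot (length x ∸ k) (rot k x) p≤′ n∸k≤ per)
  where
  p≤′ = subst (p ≤_) (sym (length-rot k x)) p≤
  n∸k≤ = subst (length x ∸ k ≤_) (sym (length-rot k x)) (m∸n≤m _ k)

length-neck : ∀ x → length (neck x) ≡ length x
length-neck x with neck-rotation x
... | inj₁ eq            = cong length eq
... | inj₂ (k , _ , eq) = trans (cong length eq) (length-rot k x)

setLastZero-∷ʳ : ∀ u b → setLastZero (u ∷ʳ b) ≡ u ∷ʳ false
setLastZero-∷ʳ u b = cong (_∷ʳ false) (begin
  take (length (u ∷ʳ b) ∸ 1) (u ∷ʳ b) ≡⟨ cong (λ m → take (m ∸ 1) (u ∷ʳ b)) (length-++ u) ⟩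
  take (length u + 1 ∸ 1) (u ∷ʳ b)    ≡⟨ cong (λ m → take m (u ∷ʳ b)) (m+n∸n≡m (length u) 1) ⟩
  take (length u) (u ∷ʳ b)            ≡⟨ take-length-++ u ⟩
  u                                   ∎)
  where open ≡-Reasoning

firstOne-cases : ∀ x → (x ≡ zeros (length x) × firstOne x ≡ x)
                     ⊎ ∃[ i ] ∃[ s ] x ≡ zeros i ++ true ∷ s × firstOne x ≡ zeros i ++ false ∷ s
firstOne-cases []          = inj₁ (refl , refl)
firstOne-cases (true ∷ x)  = inj₂ (0 , x , refl , refl)
firstOne-cases (false ∷ x) with firstOne-cases x
... | inj₁ (x≡ , fx≡)         = inj₁ (cong (false ∷_) x≡ , cong (false ∷_) fx≡)
... | inj₂ (i , s , x≡ , fx≡) = inj₂ (suc i , s , cong (false ∷_) x≡ , cong (false ∷_) fx≡)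

flipFirstZero : BStr → BStr
flipFirstZero []           = []
flipFirstZero (true ∷ xs)  = true ∷ flipFirstZero xs
flipFirstZero (false ∷ xs) = true ∷ xs

flipFirstZero-unique : (g : BStr → BStr) → g [] ≡ [] → (∀ xs → g (true ∷ xs) ≡ true ∷ g xs) →
                       (∀ xs → g (false ∷ xs) ≡ true ∷ xs) → ∀ xs → g xs ≡ flipFirstZero xs
flipFirstZero-unique g g[] g1 g0 []           = g[]
flipFirstZero-unique g g[] g1 g0 (true ∷ xs)  =
  trans (g1 xs) (cong (true ∷_) (flipFirstZero-unique g g[] g1 g0 xs))
flipFirstZero-unique g g[] g1 g0 (false ∷ xs) = g0 xs

-- The worker of lastZero is local to Defs and cannot be named.  Abstracting over
-- `reverse x` exposes it applied to a variable, so the placeholder `worker` is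
-- solved by unification, and abstracting over `reverse` lets the unifier peel it off.
lastZero-reverse : ∀ x → lastZero x ≡ reverse (flipFirstZero (reverse x))
lastZero-reverse x = unfolded
  where
  worker : BStr → BStr
  worker = _
  unfolded : lastZero x ≡ reverse (flipFirstZero (reverse x))
  unfolded with reverse x
  ... | w with reverse {A = Bool}
  ... | rev = cong rev (flipFirstZero-unique worker refl (λ _ → refl) (λ _ → refl) w)

flipFirstZero-cases : ∀ ys → (ys ≡ ones (length ys) × flipFirstZero ys ≡ ys)
                           ⊎ ∃[ q ] ∃[ s ] ys ≡ ones q ++ false ∷ s × flipFirstZero ys ≡ ones q ++ true ∷ s
flipFirstZero-cases []           = inj₁ (refl , refl)
flipFirstZero-cases (false ∷ ys) = inj₂ (0 , ys , refl , refl)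
flipFirstZero-cases (true ∷ ys)  with flipFirstZero-cases ys
... | inj₁ (ys≡ , fys≡)         = inj₁ (cong (true ∷_) ys≡ , cong (true ∷_) fys≡)
... | inj₂ (q , s , ys≡ , fys≡) = inj₂ (suc q , s , cong (true ∷_) ys≡ , cong (true ∷_) fys≡)

reverse-ones-++-∷ : ∀ q b s → reverse (ones q ++ b ∷ s) ≡ reverse s ++ b ∷ ones q
reverse-ones-++-∷ q b s = begin
  reverse (ones q ++ b ∷ s)           ≡⟨ reverse-++ (ones q) (b ∷ s) ⟩
  reverse (b ∷ s) ++ reverse (ones q) ≡⟨ cong₂ _++_ (unfold-reverse b s) (reverse-replicate q) ⟩
  (reverse s ∷ʳ b) ++ ones q          ≡⟨ ++-assoc (reverse s) [ b ] (ones q) ⟩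
  reverse s ++ b ∷ ones q             ∎
  where open ≡-Reasoning

lastZero-cases : ∀ x → (x ≡ ones (length x) × lastZero x ≡ x)
                     ⊎ ∃[ t ] ∃[ q ] x ≡ t ++ false ∷ ones q × lastZero x ≡ t ++ true ∷ ones q
lastZero-cases x with flipFirstZero-cases (reverse x)
... | inj₁ (rx≡ , frx≡) =
  inj₁ (x≡ , trans (lastZero-reverse x) (trans (cong reverse frx≡) (reverse-involutive x)))
  where
  x≡ : x ≡ ones (length x)
  x≡ = begin
    x                                   ≡⟨ sym (reverse-involutive x) ⟩
    reverse (reverse x)                 ≡⟨ cong reverse rx≡ ⟩
    reverse (ones (length (reverse x))) ≡⟨ reverse-replicate _ ⟩
    ones (length (reverse x))           ≡⟨ cong ones (length-reverse x) ⟩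
    ones (length x)                     ∎
    where open ≡-Reasoning
... | inj₂ (q , s , rx≡ , frx≡) = inj₂ (reverse s , q ,
  trans (sym (reverse-involutive x)) (trans (cong reverse rx≡) (reverse-ones-++-∷ q false s)) ,
  trans (lastZero-reverse x) (trans (cong reverse frx≡) (reverse-ones-++-∷ q true s)))

periodic≢firstOne : ∀ {α β p} → IsBracelet α → ¬ IsSymmetric β → 0 < p → p + p ≤ length β →
                    HasPeriod p β → β ≢ firstOne α
periodic≢firstOne {α} {β} {p} br β-asym p>0 2p≤n per β≡ with firstOne-cases α
... | inj₁ (α≡ , fα≡) =
  β-asym (replicate-symmetric (length α) (short-period-pos p>0 2p≤n) (trans β≡ (trans fα≡ α≡)))
... | inj₂ (i , s , α≡ , fα≡) with zeros-or-first-one β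
...   | inj₁ β≡ = β-asym (replicate-symmetric (length β) (short-period-pos p>0 2p≤n) β≡)
...   | inj₂ (z , w , β≡z) = bracelet-rot-flip (zeros i) br p<α α≡ rot≡
  where
  open ≡-Reasoning
  β≡i : β ≡ zeros i ++ false ∷ s
  β≡i = trans β≡ fα≡
  i<p : i < p
  i<p = <-≤-trans (zeros-≤-first-one (suc i) z (trans (zeros-suc i) (trans (sym β≡i) β≡z)))
                  (<⇒≤ (period-leading-zeros p>0 per β≡z))
  -- the letter flipped by firstOne lies before position p
  drop≡ : drop p α ≡ drop p β
  drop≡ = begin
    drop p α                      ≡⟨ cong (drop p) α≡ ⟩
    drop p (zeros i ++ true ∷ s)  ≡⟨ drop-beyond-∷ p (zeros i) (subst (_< p) (sym (length-replicate i)) i<p) ⟩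
    drop p (zeros i ++ false ∷ s) ≡⟨ cong (drop p) (sym β≡i) ⟩
    drop p β                      ∎
  prefix = ++-prefix-∷ (zeros i) (drop p β)
             (subst₂ _<_ (sym (length-replicate i)) (sym (length-drop p β)) (<-period⇒<-∸ i<p 2p≤n))
             (trans per β≡i)
  d = proj₁ prefix
  rot≡ : rot p α ≡ zeros i ++ false ∷ (d ++ take p α)
  rot≡ = begin
    drop p α ++ take p α               ≡⟨ cong (_++ take p α) (trans drop≡ (proj₂ prefix)) ⟩
    (zeros i ++ false ∷ d) ++ take p α ≡⟨ ++-assoc (zeros i) (false ∷ d) (take p α) ⟩
    zeros i ++ false ∷ (d ++ take p α) ∎
  p<α : p < length α
  p<α = subst (p <_) (trans (cong length β≡i) (trans (length-++-∷ (zeros i)) (cong length (sym α≡))))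
              (short-period-< p>0 2p≤n)

palindrome-∷ʳ-symmetric : ∀ u {b} → reverse u ≡ u → IsSymmetric (u ∷ʳ b)
palindrome-∷ʳ-symmetric u {b} u-pal = length u , u<n , (begin
  reverse (u ∷ʳ b)        ≡⟨ reverse-++ u [ b ] ⟩
  b ∷ reverse u           ≡⟨ cong (b ∷_) u-pal ⟩
  b ∷ u                   ≡⟨ sym (rot-length-∷ʳ u b) ⟩
  rot (length u) (u ∷ʳ b) ∎)
  where
  open ≡-Reasoning
  u<n = subst (length u <_) (sym (length-++ u)) (m<m+n (length u) (s≤s z≤n))

periodic≢lastOne : ∀ {α β p} → IsBracelet α → ¬ IsSymmetric α → 0 < p → p + p ≤ length β →
                   HasPeriod p β → β ≢ lastOne α
periodic≢lastOne {α} {β} {suc p} br α-asym p>0 2p≤n per β≡ with initLast α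
-- lastOne [] ≡ [ false ] is too short to have a period
... | [] = <⇒≱ p>0 (≤-pred (short-period-< p>0 (subst (λ x → suc p + suc p ≤ length x) β≡ 2p≤n)))
... | u ∷ʳ′ b = lastOne-snoc (zeros-or-first-one u)
  where
  α' = u ∷ʳ false
  ∣u∷ʳ∣ : ∀ c → length (u ∷ʳ c) ≡ suc (length u)
  ∣u∷ʳ∣ c = trans (length-++ u) (+-comm (length u) 1)
  β≡neck : β ≡ neck α'
  β≡neck = trans β≡ (cong neck (setLastZero-∷ʳ u b))
  ∣β∣≡1+∣u∣ : length β ≡ suc (length u)
  ∣β∣≡1+∣u∣ = trans (cong length β≡neck) (trans (length-neck α') (∣u∷ʳ∣ false))
  p<∣u∣ : p < length u
  p<∣u∣ = ≤-pred (subst (suc p <_) ∣β∣≡1+∣u∣ (short-period-< p>0 2p≤n))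
  p<∣α'∣ : suc p ≤ length α'
  p<∣α'∣ = subst (suc p ≤_) (sym (∣u∷ʳ∣ false)) (m≤n⇒m≤1+n p<∣u∣)
  α'-period : HasPeriod (suc p) α'
  α'-period = rotation-period α' p<∣α'∣ (neck-rotation α') (subst (HasPeriod (suc p)) β≡neck per)
  lastOne-snoc : (u ≡ zeros (length u) ⊎ ∃[ i ] ∃[ w ] u ≡ zeros i ++ true ∷ w) → ⊥
  lastOne-snoc (inj₁ u≡) =
    α-asym (palindrome-∷ʳ-symmetric u (trans (cong reverse u≡) (trans (reverse-replicate _) (sym u≡))))
  -- rotating α' by p - 1 brings its final 0 to the front, after which come the i zeros of u
  lastOne-snoc (inj₂ (i , w , u≡)) = bracelet-rot-flip (zeros i) br p<n α≡ rot≡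
    where
    open ≡-Reasoning
    α'≡ : α' ≡ zeros i ++ true ∷ (w ∷ʳ false)
    α'≡ = trans (cong (_∷ʳ false) u≡) (++-assoc (zeros i) (true ∷ w) [ false ])
    α≡ : u ∷ʳ b ≡ zeros i ++ true ∷ (w ∷ʳ b)
    α≡ = trans (cong (_∷ʳ b) u≡) (++-assoc (zeros i) (true ∷ w) [ b ])
    p<n : p < length (u ∷ʳ b)
    p<n = subst (p <_) (sym (∣u∷ʳ∣ b)) (m<n⇒m<1+n p<∣u∣)
    i<p : i < suc p
    i<p = period-leading-zeros p>0 α'-period α'≡
    eq : drop p u ++ false ∷ take p u ≡ zeros i ++ false ∷ true ∷ w
    eq = trans (period-pred-drop p u p<∣α'∣ α'-period) (trans (cong (false ∷_) u≡) (zeros-suc i))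
    i<drop : length (zeros i) < length (drop p u)
    i<drop = subst₂ _<_ (sym (length-replicate i)) (trans (cong (_∸ suc p) ∣β∣≡1+∣u∣) (sym (length-drop p u)))
                    (<-period⇒<-∸ i<p 2p≤n)
    prefix = ++-prefix-∷ (zeros i) (drop p u) i<drop eq
    d = proj₁ prefix
    rot≡ : rot p (u ∷ʳ b) ≡ zeros i ++ false ∷ (d ++ b ∷ take p u)
    rot≡ = begin
      rot p (u ∷ʳ b)                         ≡⟨ rot-++ˡ p u (<⇒≤ p<∣u∣) ⟩
      drop p u ++ b ∷ take p u               ≡⟨ cong (_++ b ∷ take p u) (proj₂ prefix) ⟩
      (zeros i ++ false ∷ d) ++ b ∷ take p u ≡⟨ ++-assoc (zeros i) (false ∷ d) (b ∷ take p u) ⟩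
      zeros i ++ false ∷ (d ++ b ∷ take p u) ∎

periodic≢lastZero : ∀ {α β p} → IsBracelet α → ¬ IsSymmetric β → 0 < p → p + p ≤ length β →
                    HasPeriod p β → β ≢ lastZero α
periodic≢lastZero {α} {β} {p} br β-asym p>0 2p≤n per β≡ with lastZero-cases α
... | inj₁ (α≡ , lzα≡) =
  β-asym (replicate-symmetric (length α) (short-period-pos p>0 2p≤n) (trans β≡ (trans lzα≡ α≡)))
... | inj₂ (t , q , α≡ , lzα≡) with p ≤? length t
-- the final run of 1s is at least a period long, so β is constant
...   | no p≰t =
  β-asym (replicate-symmetric (length (t ++ ones (suc q))) (short-period-pos p>0 2p≤n) (trans β≡t β-constant))
  where
  β≡t : β ≡ t ++ ones (suc q)
  β≡t = trans β≡ lzα≡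
  t<p = ≰⇒> p≰t
  p≤q : p ≤ suc q
  p≤q = m≤n⇒m≤1+n (≤-pred (+-cancelˡ-≤ (length t) (suc p) (suc q) (begin
    length t + suc p                 ≡⟨ +-suc (length t) p ⟩
    suc (length t) + p               ≤⟨ +-monoˡ-≤ p t<p ⟩
    p + p                            ≤⟨ 2p≤n ⟩
    length β                         ≡⟨ cong length β≡t ⟩
    length (t ++ ones (suc q))       ≡⟨ length-++ t ⟩
    length t + length (ones (suc q)) ≡⟨ cong (length t +_) (length-replicate (suc q)) ⟩
    length t + suc q                 ∎)))
    where open ≤-Reasoning
  β-constant : Constant true (t ++ ones (suc q))
  β-constant = period-constant-suffix t (suc q) (<⇒≤ t<p) p≤q (subst (HasPeriod p) β≡t per)
-- by the period, β also has a 1 at position ∣t∣ - p, where rot p α has its 0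
...   | yes p≤t = bracelet-rot-flip (drop p t) br p<α α≡′ rot≡
  where
  open ≡-Reasoning
  β≡t : β ≡ t ++ true ∷ ones q
  β≡t = trans β≡ lzα≡
  eq : t ++ true ∷ ones q ≡ drop p t ++ true ∷ (ones q ++ take p t)
  eq = begin
    t ++ true ∷ ones q                      ≡⟨ sym β≡t ⟩
    β                                       ≡⟨ sym per ⟩
    rot p β                                 ≡⟨ cong (rot p) β≡t ⟩
    rot p (t ++ true ∷ ones q)              ≡⟨ rot-++ˡ p t p≤t ⟩
    drop p t ++ true ∷ (ones q ++ take p t) ∎
  drop<t : length (drop p t) < length t
  drop<t = subst (_< length t) (sym (length-drop p t)) (∸-monoʳ-< p>0 p≤t)
  prefix = ++-prefix-∷ (drop p t) t drop<t eq
  t′ = proj₁ prefix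
  α≡′ : α ≡ drop p t ++ true ∷ (t′ ++ false ∷ ones q)
  α≡′ = trans α≡ (trans (cong (_++ false ∷ ones q) (proj₂ prefix))
                        (++-assoc (drop p t) (true ∷ t′) (false ∷ ones q)))
  rot≡ : rot p α ≡ drop p t ++ false ∷ (ones q ++ take p t)
  rot≡ = trans (cong (rot p) α≡) (rot-++ˡ p t p≤t)
  p<α : p < length α
  p<α = subst (p <_) (trans (cong length β≡t) (trans (length-++-∷ t) (cong length (sym α≡))))
              (short-period-< p>0 2p≤n)

lemma3 : (n : ℕ) → 6 ≤ n → (β : BStr) → InA n β → IsPeriodic β →
    (α : BStr) → InA n α → ¬ (α ≡ r n) → ¬ Par n α β
lemma3 _ _ β (_ , _ , β-asym) β-periodic α (_ , α-bracelet , α-asym) _ par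
  with p , p>0 , 2p≤n , β-period ← periodic⇒short-period β-periodic
  with par
... | inj₁ (_ , β≡) =
  periodic≢firstOne α-bracelet β-asym p>0 2p≤n β-period β≡
... | inj₂ (inj₁ (_ , _ , β≡)) =
  periodic≢lastOne α-bracelet α-asym p>0 2p≤n β-period β≡
... | inj₂ (inj₂ (_ , _ , β≡)) =
  periodic≢lastZero α-bracelet β-asym p>0 2p≤n β-period β≡
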